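{- Let $\ell\geq 2$ and let $G_\ell$ be the $\ell\times\ell$ grid graph. Let $\{x,y\}$ be a diagonal pair of $G_\ell$ with $x<y$ and $d(x,y)=2$. Then the set $R(x,y)$ of vertices of $G_\ell$ resolving $\{x,y\}$ equals $Q_2(x)\cup Q_4(y)$.
   Context: $G_\ell$ has vertex set $[0,\ell-1]\times[0,\ell-1]$ (integer points), two vertices adjacent when they differ by $1$ in exactly one coordinate, so $d((x_1,x_2),(y_1,y_2))=|x_1-y_1|+|x_2-y_2|$. For $x=(x_1,x_2)$: $Q_2(x)=\{y\in V(G_\ell): y_1\leq x_1, y_2\geq x_2\}$ and $Q_4(x)=\{y\in V(G_\ell): y_1\geq x_1, y_2\leq x_2\}$. The diagonals are $D_i=\{x\in V(G_\ell): x_1+x_2=i\}$ for $0\le i\le \ell-1$; a pair $\{x,y\}$ is a diagonal pair if $x,y\in D_i$ for some $i$, and its elements are ordered by $x<y$ iff $x_1<y_1$. A vertex $u$ resolves $\{x,y\}$ if $d(u,x)\neq d(u,y)$, and $R(x,y)$ is the set of vertices resolving $\{x,y\}$. -}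

module Defs where

open import Data.Nat using (ℕ; _+_; _≤_; _<_; _∸_; ∣_-_∣)
open import Data.Fin using (Fin; toℕ)
open import Data.Product using (_×_; _,_; Σ; ∃-syntax)
open import Level using (0ℓ)
open import Relation.Binary.PropositionalEquality using (_≡_; _≢_)
open import Relation.Unary using (Pred)

Vertex : ℕ → Set
Vertex ℓ = Fin ℓ × Fin ℓ

module _ {ℓ : ℕ} where

  c₁ c₂ : Vertex ℓ → ℕ
  c₁ (a , _) = toℕ a
  c₂ (_ , b) = toℕ b

  -- graph distance in G_ℓ (Manhattan distance)
  d : Vertex ℓ → Vertex ℓ → ℕ
  d x y = ∣ c₁ x - c₁ y ∣ + ∣ c₂ x - c₂ y ∣

  Q₂ : Vertex ℓ → Pred (Vertex ℓ) 0ℓ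
  Q₂ x y = c₁ y ≤ c₁ x × c₂ x ≤ c₂ y

  Q₄ : Vertex ℓ → Pred (Vertex ℓ) 0ℓ
  Q₄ x y = c₁ x ≤ c₁ y × c₂ y ≤ c₂ x

  InDiagonal : ℕ → Vertex ℓ → Set
  InDiagonal i x = c₁ x + c₂ x ≡ i

  DiagonalPair : Vertex ℓ → Vertex ℓ → Set
  DiagonalPair x y = ∃[ i ] (i ≤ ℓ ∸ 1 × InDiagonal i x × InDiagonal i y)

  _<ᵈ_ : Vertex ℓ → Vertex ℓ → Set
  x <ᵈ y = c₁ x < c₁ y

  Resolves : Vertex ℓ → Vertex ℓ → Vertex ℓ → Set
  Resolves u x y = d u x ≢ d u y

  R : Vertex ℓ → Vertex ℓ → Pred (Vertex ℓ) 0ℓ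
  R x y u = Resolves u x y

module Submission where

-- Write a vertex u = (p , q).  Moving a target one step to the
-- right along the first coordinate changes the distance from p by exactly
-- one:  ∣ p - (a+1) ∣ = ∣ p - a ∣ + 1 when p ≤ a, and
-- ∣ p - a ∣ = ∣ p - (a+1) ∣ + 1 when a < p  (lemma distance-step).
-- A diagonal pair x < y at distance 2 has the shape x = (a , b+1),
-- y = (a+1 , b)  (lemma diagonal-neighbours).  Comparing d(u,x) and d(u,y)
-- coordinatewise with distance-step gives four cases: in two of them the
-- two unit changes cancel and u does not resolve {x,y}; in the other two
-- they add up, so the distances differ by 2 — and these are exactly
-- p ≤ a , b < q  (u ∈ Q₂(x))  and  a < p , q ≤ b  (u ∈ Q₄(y))
-- (lemma resolvers-of-neighbours).

open import Defs
open import Data.Nat using (ℕ; _≤_)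
open import Relation.Binary.PropositionalEquality using (_≡_)
open import Relation.Unary using (_≐_; _∪_)

open import Data.Nat using (zero; suc; _+_; _<_; s≤s; z≤n; ∣_-_∣)
open import Data.Nat.Properties
  using ( suc-injective; n<1+n; <⇒≤; <⇒≢; <⇒≱; m≤n⇒∃[o]m+o≡n
        ; +-suc; +-comm; +-assoc; +-cancelˡ-≡; +-mono-<; m+n≡0⇒n≡0
        ; ∣-∣-identityʳ; ∣-∣-comm; ∣m-m+n∣≡n )
open import Data.Fin using (toℕ)
open import Data.Product using (_×_; _,_; proj₁; proj₂)
open import Data.Sum using (_⊎_; inj₁; inj₂)
open import Data.Empty using (⊥-elim)
open import Relation.Binary.PropositionalEquality using (refl; sym; trans; cong; cong₂; _≢_; module ≡-Reasoning)

distance-step : ∀ p a →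
  (p ≤ a × ∣ p - suc a ∣ ≡ suc ∣ p - a ∣) ⊎ (a < p × ∣ p - a ∣ ≡ suc ∣ p - suc a ∣)
distance-step zero    a       = inj₁ (z≤n , refl)
distance-step (suc p) zero    = inj₂ (s≤s z≤n , cong suc (sym (∣-∣-identityʳ p)))
distance-step (suc p) (suc a) with distance-step p a
... | inj₁ (p≤a , e) = inj₁ (s≤s p≤a , e)
... | inj₂ (a<p , e) = inj₂ (s≤s a<p , e)

sum-grows : ∀ m n → m + n ≢ suc m + suc n
sum-grows m n = <⇒≢ (+-mono-< (n<1+n m) (n<1+n n))

resolvers-of-neighbours : ∀ {a b a' b'} p q → a' ≡ suc a → b ≡ suc b' →
  ((∣ p - a ∣ + ∣ q - b ∣ ≢ ∣ p - a' ∣ + ∣ q - b' ∣) → (p ≤ a × b ≤ q) ⊎ (a' ≤ p × q ≤ b'))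
  × ((p ≤ a × b ≤ q) ⊎ (a' ≤ p × q ≤ b') → (∣ p - a ∣ + ∣ q - b ∣ ≢ ∣ p - a' ∣ + ∣ q - b' ∣))
resolvers-of-neighbours {a = a} {b' = b} p q refl refl
  with distance-step p a | distance-step q b
-- p ≤ a, q ≤ b: both distances grow by one, so d(u,x) = d(u,y).
... | inj₁ (p≤a , ep) | inj₁ (q≤b , eq) rewrite ep | eq =
  (λ resolves → ⊥-elim (resolves (+-suc ∣ p - a ∣ ∣ q - b ∣)))
  , λ { (inj₁ (_ , b<q)) → ⊥-elim (<⇒≱ b<q q≤b)
      ; (inj₂ (a<p , _)) → ⊥-elim (<⇒≱ a<p p≤a) }
-- p ≤ a, b < q: u ∈ Q₂(x) and d(u,y) = d(u,x) + 2.
... | inj₁ (p≤a , ep) | inj₂ (b<q , eq) rewrite ep | eq =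
  (λ _ → inj₁ (p≤a , b<q))
  , λ _ → sum-grows ∣ p - a ∣ ∣ q - suc b ∣
-- a < p, q ≤ b: u ∈ Q₄(y) and d(u,x) = d(u,y) + 2.
... | inj₂ (a<p , ep) | inj₁ (q≤b , eq) rewrite ep | eq =
  (λ _ → inj₂ (a<p , q≤b))
  , λ _ e → sum-grows ∣ p - suc a ∣ ∣ q - b ∣ (sym e)
-- a < p, b < q: the two changes cancel, so d(u,x) = d(u,y).
... | inj₂ (a<p , ep) | inj₂ (b<q , eq) rewrite ep | eq =
  (λ resolves → ⊥-elim (resolves (sym (+-suc ∣ p - suc a ∣ ∣ q - suc b ∣))))
  , λ { (inj₁ (p≤a , _)) → ⊥-elim (<⇒≱ a<p p≤a)
      ; (inj₂ (_ , q≤b)) → ⊥-elim (<⇒≱ b<q q≤b) }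

double≡2 : ∀ s → s + s ≡ 2 → s ≡ 1
double≡2 zero          ()
double≡2 (suc zero)    _ = refl
double≡2 (suc (suc s)) e with () ← m+n≡0⇒n≡0 s (suc-injective (suc-injective e))

diagonal-shift : ∀ a s b b' → a + b ≡ (a + s) + b' → b ≡ s + b'
diagonal-shift a s b b' same-diagonal =
  +-cancelˡ-≡ a b (s + b') (trans same-diagonal (+-assoc a s b'))

shift-gap : ∀ s b' → ∣ s + b' - b' ∣ ≡ s
shift-gap s b' = begin
  ∣ s + b' - b' ∣ ≡⟨ ∣-∣-comm (s + b') b' ⟩
  ∣ b' - s + b' ∣ ≡⟨ cong ∣ b' -_∣ (+-comm s b') ⟩
  ∣ b' - b' + s ∣ ≡⟨ ∣m-m+n∣≡n b' s ⟩
  s               ∎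
  where open ≡-Reasoning

-- Two points (a , b), (a' , b') on a common diagonal with a < a' at
-- Manhattan distance 2 are neighbours on it: a' = a+1 and b = b'+1.
-- Writing a' = a + s, both coordinates differ by s, so s + s = 2.
diagonal-neighbours : ∀ a b a' b' → a + b ≡ a' + b' → a < a' →
  ∣ a - a' ∣ + ∣ b - b' ∣ ≡ 2 → a' ≡ suc a × b ≡ suc b'
diagonal-neighbours a b a' b' same-diagonal a<a' dist
  with s , refl ← m≤n⇒∃[o]m+o≡n (<⇒≤ a<a')
  with refl ← diagonal-shift a s b b' same-diagonal
  with refl ← double≡2 s (trans (cong₂ _+_ (sym (∣m-m+n∣≡n a s)) (sym (shift-gap s b'))) dist)
  = +-comm a 1 , refl

lemma3p1 : (ℓ : ℕ) → 2 ≤ ℓ → (x y : Vertex ℓ) → DiagonalPair x y → x <ᵈ y → d x y ≡ 2 →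
    R x y ≐ (Q₂ x ∪ Q₄ y)
lemma3p1 ℓ _ x@(x₁ , x₂) y@(y₁ , y₂) (_ , _ , x∈Dᵢ , y∈Dᵢ) x<y dxy =
  (λ {u} → proj₁ (characterisation u)) , (λ {u} → proj₂ (characterisation u))
  where
  neighbours : toℕ y₁ ≡ suc (toℕ x₁) × toℕ x₂ ≡ suc (toℕ y₂)
  neighbours = diagonal-neighbours (toℕ x₁) (toℕ x₂) (toℕ y₁) (toℕ y₂)
                 (trans x∈Dᵢ (sym y∈Dᵢ)) x<y dxy

  characterisation : ∀ u → (R x y u → (Q₂ x ∪ Q₄ y) u) × ((Q₂ x ∪ Q₄ y) u → R x y u)
  characterisation (p , q) =
    resolvers-of-neighbours (toℕ p) (toℕ q) (proj₁ neighbours) (proj₂ neighbours)
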